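{- Let $A_0=1$ and for $p>0$ let $A_p = (-1)^p + 2\sum_{j=0}^{\lfloor p/2\rfloor}\binom{p}{2j+1}A_{p-2j-1}$; let $B_0=1$ and for $p>0$ let $B_p = 2\sum_{j=0}^{\lfloor p/2\rfloor}\binom{p}{2j+1}B_{p-2j-1}$. Then for every integer $k\ge 1$, \[ A_k \;=\; \sum_{j=0}^{k-1}\binom{k}{j} B_j. \]
   Context: Binomial coefficients $\binom{p}{m}$ with $m>p$ are $0$, so in the recursive definitions only terms with $2j+1\le p$ contribute. -}

module Defs where

open import Data.Nat using (ℕ; zero; suc; _∸_; _≤ᵇ_; ⌊_/2⌋)
open import Data.Nat.Combinatorics using (_C_)
open import Data.Integer using (ℤ; +_; _+_; _*_; -_)
import Data.Nat as ℕ
open import Data.Bool using (if_then_else_)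

Σ≤ : ℕ → (ℕ → ℤ) → ℤ
Σ≤ zero    f = f zero
Σ≤ (suc n) f = Σ≤ n f + f (suc n)

Σ< : ℕ → (ℕ → ℤ) → ℤ
Σ< zero    f = + 0
Σ< (suc n) f = Σ< n f + f n

sgn : ℕ → ℤ
sgn zero    = + 1
sgn (suc p) = - sgn p

oddSum : ℕ → (ℕ → ℤ) → ℤ
oddSum p X = + 2 * Σ≤ ⌊ p /2⌋ (λ j → + (p C (2j+1 j)) * X (p ∸ 2j+1 j))
  where
  2j+1 : ℕ → ℕ
  2j+1 j = suc (j ℕ.+ j)

-- Course-of-values tables: (upto n) i is the correct value for every i ≤ n.
-- A_0 = 1, A_p = (-1)^p + oddSum p A  (p > 0)
A-upto : ℕ → ℕ → ℤ
A-upto zero    i = + 1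
A-upto (suc n) i = if i ≤ᵇ n then A-upto n i
                   else (sgn (suc n) + oddSum (suc n) (A-upto n))

B-upto : ℕ → ℕ → ℤ
B-upto zero    i = + 1
B-upto (suc n) i = if i ≤ᵇ n then B-upto n i
                   else oddSum (suc n) (B-upto n)

A : ℕ → ℤ
A p = A-upto p p

B : ℕ → ℤ
B p = B-upto p p

-- Read the sequences as exponential generating functions, so that ⋆ is their product,
-- δ is 1, ones is e^x, sgn is e^{-x} and twiceOdd is S = 2 sinh x. The recurrences say
-- A = e^{-x} + S A and B = 1 + S B. Hence E = B e^x - B + 1 satisfies
-- S E = (B - 1) e^x - (B - 1) + e^x - e^{-x} = E - e^{-x}, the recurrence of A; as S has
-- no constant term that recurrence has only one solution, so A = E, whose k-th coefficient
-- for k ≥ 1 is Σ_{j<k} C(k,j) B_j. Associativity of ⋆ comes from the Leibniz rule for the shift.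
module Submission where

open import Defs
open import Data.Bool using (true; false; if_then_else_)
open import Data.Nat using (ℕ; zero; suc; _≥_; _≤_; _<_; _≤′_; _∸_; _<ᵇ_; _≤ᵇ_; ⌊_/2⌋; z≤n; s≤s)
import Data.Nat as ℕ
import Data.Nat.Properties as ℕP
open import Data.Nat.Combinatorics using (_C_; nCk+nC[k+1]≡[n+1]C[k+1]; k>n⇒nCk≡0; nCn≡1; nCk≡nC[n∸k])
open import Data.Nat.Induction using (<-rec)
open import Data.Integer using (ℤ; +_; _+_; _*_; -_; _-_)
import Data.Integer.Properties as ℤP
open import Data.Integer.Tactic.RingSolver using (solve-∀)
open import Relation.Nullary.Reflects using (ofʸ; ofⁿ)
open import Relation.Binary.PropositionalEquality
  using (_≡_; _≗_; refl; sym; trans; cong; cong₂; module ≡-Reasoning)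
open ≡-Reasoning

Σ≤-cong : ∀ n {f g : ℕ → ℤ} → (∀ j → j ≤ n → f j ≡ g j) → Σ≤ n f ≡ Σ≤ n g
Σ≤-cong zero    f≡g = f≡g 0 z≤n
Σ≤-cong (suc n) f≡g =
  cong₂ _+_ (Σ≤-cong n (λ j j≤n → f≡g j (ℕP.m≤n⇒m≤1+n j≤n))) (f≡g (suc n) ℕP.≤-refl)

Σ≤-distrib-+ : ∀ n (f g : ℕ → ℤ) → Σ≤ n (λ j → f j + g j) ≡ Σ≤ n f + Σ≤ n g
Σ≤-distrib-+ zero    f g = refl
Σ≤-distrib-+ (suc n) f g =
  trans (cong (_+ (f (suc n) + g (suc n))) (Σ≤-distrib-+ n f g))
        (interchange (Σ≤ n f) (Σ≤ n g) (f (suc n)) (g (suc n)))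
  where
  interchange : ∀ a b c d → (a + b) + (c + d) ≡ (a + c) + (b + d)
  interchange = solve-∀

Σ≤-neg : ∀ n (f : ℕ → ℤ) → Σ≤ n (λ j → - f j) ≡ - Σ≤ n f
Σ≤-neg zero    f = refl
Σ≤-neg (suc n) f =
  trans (cong (_+ (- f (suc n))) (Σ≤-neg n f)) (sym (ℤP.neg-distrib-+ (Σ≤ n f) (f (suc n))))

Σ≤-*ˡ : ∀ n c (f : ℕ → ℤ) → Σ≤ n (λ j → c * f j) ≡ c * Σ≤ n f
Σ≤-*ˡ zero    c f = refl
Σ≤-*ˡ (suc n) c f =
  trans (cong (_+ (c * f (suc n))) (Σ≤-*ˡ n c f)) (sym (ℤP.*-distribˡ-+ c (Σ≤ n f) (f (suc n))))

Σ≤-head : ∀ n (f : ℕ → ℤ) → Σ≤ (suc n) f ≡ f 0 + Σ≤ n (λ j → f (suc j))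
Σ≤-head zero    f = refl
Σ≤-head (suc n) f = trans (cong (_+ f (suc (suc n))) (Σ≤-head n f)) (ℤP.+-assoc (f 0) _ _)

Σ≤-Σ< : ∀ n (f : ℕ → ℤ) → Σ≤ n f ≡ Σ< n f + f n
Σ≤-Σ< zero    f = sym (ℤP.+-identityˡ (f 0))
Σ≤-Σ< (suc n) f = cong (_+ f (suc n)) (Σ≤-Σ< n f)

Σ≤-zero : ∀ n (f : ℕ → ℤ) → (∀ j → j ≤ n → f j ≡ + 0) → Σ≤ n f ≡ + 0
Σ≤-zero zero    f f≡0 = f≡0 0 z≤n
Σ≤-zero (suc n) f f≡0 =
  cong₂ _+_ (Σ≤-zero n f (λ j j≤n → f≡0 j (ℕP.m≤n⇒m≤1+n j≤n))) (f≡0 (suc n) ℕP.≤-refl)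

Σ≤-last : ∀ n (f : ℕ → ℤ) → (∀ j → j < n → f j ≡ + 0) → Σ≤ n f ≡ f n
Σ≤-last zero    f f≡0 = refl
Σ≤-last (suc n) f f≡0 =
  trans (cong (_+ f (suc n)) (Σ≤-zero n f (λ j j≤n → f≡0 j (s≤s j≤n)))) (ℤP.+-identityˡ (f (suc n)))

Σ≤-extend : ∀ {n m} (f : ℕ → ℤ) → (∀ j → n < j → f j ≡ + 0) → n ≤′ m → Σ≤ n f ≡ Σ≤ m f
Σ≤-extend f f≡0 ℕ.≤′-refl            = refl
Σ≤-extend {n} f f≡0 (ℕ.≤′-step {m} n≤m) = begin
  Σ≤ n f                ≡⟨ Σ≤-extend f f≡0 n≤m ⟩
  Σ≤ m f                ≡⟨ sym (ℤP.+-identityʳ _) ⟩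
  Σ≤ m f + + 0          ≡⟨ cong (_+_ (Σ≤ m f)) (sym (f≡0 (suc m) (s≤s (ℕP.≤′⇒≤ n≤m)))) ⟩
  Σ≤ (suc m) f          ∎

Σ≤-pairs : ∀ q (h : ℕ → ℤ) → Σ≤ (suc (q ℕ.+ q)) h ≡ Σ≤ q (λ j → h (j ℕ.+ j) + h (suc (j ℕ.+ j)))
Σ≤-pairs zero    h = refl
Σ≤-pairs (suc q) h rewrite ℕP.+-suc q q =
  trans (cong (λ x → x + h (suc (suc (q ℕ.+ q))) + h (suc (suc (suc (q ℕ.+ q))))) (Σ≤-pairs q h))
        (ℤP.+-assoc (Σ≤ q (λ j → h (j ℕ.+ j) + h (suc (j ℕ.+ j)))) _ _)

infixl 7 _⋆_

_⋆_ : (ℕ → ℤ) → (ℕ → ℤ) → ℕ → ℤ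
(f ⋆ g) p = Σ≤ p (λ j → + (p C j) * f j * g (p ∸ j))

shift : (ℕ → ℤ) → ℕ → ℤ
shift f n = f (suc n)

δ : ℕ → ℤ
δ zero    = + 1
δ (suc _) = + 0

⋆-cong : ∀ {f f′ g g′ : ℕ → ℤ} → f ≗ f′ → g ≗ g′ → f ⋆ g ≗ f′ ⋆ g′
⋆-cong f≗f′ g≗g′ p = Σ≤-cong p (λ j _ → cong₂ (λ a b → + (p C j) * a * b) (f≗f′ j) (g≗g′ (p ∸ j)))

⋆-distribˡ-+ : ∀ (f g h : ℕ → ℤ) p → (f ⋆ (λ n → g n + h n)) p ≡ (f ⋆ g) p + (f ⋆ h) p
⋆-distribˡ-+ f g h p = trans
  (Σ≤-cong p (λ j _ → ℤP.*-distribˡ-+ (+ (p C j) * f j) (g (p ∸ j)) (h (p ∸ j))))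
  (Σ≤-distrib-+ p _ _)

⋆-distribʳ-+ : ∀ (f g h : ℕ → ℤ) p → ((λ n → f n + g n) ⋆ h) p ≡ (f ⋆ h) p + (g ⋆ h) p
⋆-distribʳ-+ f g h p = trans
  (Σ≤-cong p (λ j _ → distrib (+ (p C j)) (f j) (g j) (h (p ∸ j))))
  (Σ≤-distrib-+ p _ _)
  where
  distrib : ∀ c a b y → c * (a + b) * y ≡ c * a * y + c * b * y
  distrib = solve-∀

⋆-negʳ : ∀ (f g : ℕ → ℤ) p → (f ⋆ (λ n → - g n)) p ≡ - (f ⋆ g) p
⋆-negʳ f g p = trans
  (Σ≤-cong p (λ j _ → sym (ℤP.neg-distribʳ-* (+ (p C j) * f j) (g (p ∸ j)))))
  (Σ≤-neg p _)

nC0≡1 : ∀ n → n C 0 ≡ 1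
nC0≡1 n = trans (nCk≡nC[n∸k] {0} {n} z≤n) (nCn≡1 n)

⋆-identityˡ : ∀ f → δ ⋆ f ≗ f
⋆-identityˡ f zero    = ℤP.*-identityˡ (f 0)
⋆-identityˡ f (suc p) = begin
  (δ ⋆ f) (suc p)
    ≡⟨ Σ≤-head p _ ⟩
  + (suc p C 0) * + 1 * f (suc p) + Σ≤ p (λ j → + (suc p C suc j) * + 0 * f (p ∸ j))
    ≡⟨ cong₂ _+_ (cong (λ c → + c * + 1 * f (suc p)) (nC0≡1 (suc p)))
                 (Σ≤-zero p _ (λ j _ → annihilate (+ (suc p C suc j)) (f (p ∸ j)))) ⟩
  + 1 * + 1 * f (suc p) + + 0
    ≡⟨ ℤP.+-identityʳ _ ⟩
  + 1 * + 1 * f (suc p)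
    ≡⟨ ℤP.*-identityˡ (f (suc p)) ⟩
  f (suc p)
    ∎
  where
  annihilate : ∀ c x → c * + 0 * x ≡ + 0
  annihilate = solve-∀

⋆-identityʳ : ∀ f → f ⋆ δ ≗ f
⋆-identityʳ f p = begin
  (f ⋆ δ) p
    ≡⟨ Σ≤-last p _ (λ j j<p → annihilate (+ (p C j) * f j) (p ∸ j) (ℕP.m<n⇒0<n∸m j<p)) ⟩
  + (p C p) * f p * δ (p ∸ p)
    ≡⟨ cong₂ (λ c m → + c * f p * δ m) (nCn≡1 p) (ℕP.n∸n≡0 p) ⟩
  + 1 * f p * + 1
    ≡⟨ ℤP.*-identityʳ (+ 1 * f p) ⟩
  + 1 * f p
    ≡⟨ ℤP.*-identityˡ (f p) ⟩
  f p
    ∎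
  where
  annihilate : ∀ c m → 0 < m → c * δ m ≡ + 0
  annihilate c (suc m) _ = ℤP.*-zeroʳ c

pascal : ∀ p j → + (suc p C suc j) ≡ + (p C j) + + (p C suc j)
pascal p j = trans (cong +_ (sym (nCk+nC[k+1]≡[n+1]C[k+1] p j))) (ℤP.pos-+ (p C j) (p C suc j))

⋆-shiftʳ : ∀ (f g : ℕ → ℤ) p →
           (f ⋆ shift g) p
             ≡ + (suc p C 0) * f 0 * g (suc p) + Σ≤ p (λ j → + (p C suc j) * f (suc j) * g (p ∸ j))
⋆-shiftʳ f g p = begin
  (f ⋆ shift g) p
    ≡⟨ Σ≤-cong p (λ j j≤p → cong (λ m → + (p C j) * f j * g m) (sym (ℕP.+-∸-assoc 1 j≤p))) ⟩
  Σ≤ p K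
    ≡⟨ sym (ℤP.+-identityʳ (Σ≤ p K)) ⟩
  Σ≤ p K + + 0
    ≡⟨ cong (_+_ (Σ≤ p K)) (sym K-last) ⟩
  Σ≤ (suc p) K
    ≡⟨ Σ≤-head p K ⟩
  K 0 + Σ≤ p (λ j → K (suc j))
    ≡⟨ cong (λ c → + c * f 0 * g (suc p) + Σ≤ p (λ j → K (suc j))) (trans (nC0≡1 p) (sym (nC0≡1 (suc p)))) ⟩
  + (suc p C 0) * f 0 * g (suc p) + Σ≤ p (λ j → K (suc j))
    ∎
  where
  K : ℕ → ℤ
  K j = + (p C j) * f j * g (suc p ∸ j)
  K-last : K (suc p) ≡ + 0
  K-last = cong (λ c → + c * f (suc p) * g (p ∸ p)) (k>n⇒nCk≡0 (ℕP.n<1+n p))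

⋆-shift : ∀ (f g : ℕ → ℤ) p → (f ⋆ g) (suc p) ≡ (shift f ⋆ g) p + (f ⋆ shift g) p
⋆-shift f g p = begin
  (f ⋆ g) (suc p)
    ≡⟨ Σ≤-head p _ ⟩
  H₀ + Σ≤ p (λ j → + (suc p C suc j) * f (suc j) * g (p ∸ j))
    ≡⟨ cong (_+_ H₀) (Σ≤-cong p (λ j _ → pascal-term j)) ⟩
  H₀ + Σ≤ p (λ j → U j + V j)
    ≡⟨ cong (_+_ H₀) (Σ≤-distrib-+ p U V) ⟩
  H₀ + ((shift f ⋆ g) p + Σ≤ p V)
    ≡⟨ swap H₀ ((shift f ⋆ g) p) (Σ≤ p V) ⟩
  (shift f ⋆ g) p + (H₀ + Σ≤ p V)
    ≡⟨ cong (_+_ ((shift f ⋆ g) p)) (sym (⋆-shiftʳ f g p)) ⟩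
  (shift f ⋆ g) p + (f ⋆ shift g) p
    ∎
  where
  H₀ : ℤ
  H₀ = + (suc p C 0) * f 0 * g (suc p)
  U V : ℕ → ℤ
  U j = + (p C j) * f (suc j) * g (p ∸ j)
  V j = + (p C suc j) * f (suc j) * g (p ∸ j)
  swap : ∀ a b c → a + (b + c) ≡ b + (a + c)
  swap = solve-∀
  pascal-term : ∀ j → + (suc p C suc j) * f (suc j) * g (p ∸ j) ≡ U j + V j
  pascal-term j = trans (cong (λ c → c * f (suc j) * g (p ∸ j)) (pascal p j))
                        (distrib (+ (p C j)) (+ (p C suc j)) (f (suc j)) (g (p ∸ j)))
    where
    distrib : ∀ a b x y → (a + b) * x * y ≡ a * x * y + b * x * y
    distrib = solve-∀

⋆-assoc : ∀ (f g h : ℕ → ℤ) → (f ⋆ g) ⋆ h ≗ f ⋆ (g ⋆ h)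
⋆-assoc f g h zero    = reassociate (+ 1) (f 0) (g 0) (h 0)
  where
  reassociate : ∀ c a b d → c * (c * a * b) * d ≡ c * a * (c * b * d)
  reassociate = solve-∀
⋆-assoc f g h (suc p) = begin
  ((f ⋆ g) ⋆ h) (suc p)
    ≡⟨ ⋆-shift (f ⋆ g) h p ⟩
  (shift (f ⋆ g) ⋆ h) p + ((f ⋆ g) ⋆ shift h) p
    ≡⟨ cong (_+ ((f ⋆ g) ⋆ shift h) p)
            (trans (⋆-cong {g = h} (⋆-shift f g) (λ _ → refl) p) (⋆-distribʳ-+ (shift f ⋆ g) (f ⋆ shift g) h p)) ⟩
  ((shift f ⋆ g) ⋆ h) p + ((f ⋆ shift g) ⋆ h) p + ((f ⋆ g) ⋆ shift h) p
    ≡⟨ cong₂ _+_ (cong₂ _+_ (⋆-assoc (shift f) g h p) (⋆-assoc f (shift g) h p)) (⋆-assoc f g (shift h) p) ⟩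
  (shift f ⋆ (g ⋆ h)) p + (f ⋆ (shift g ⋆ h)) p + (f ⋆ (g ⋆ shift h)) p
    ≡⟨ ℤP.+-assoc ((shift f ⋆ (g ⋆ h)) p) _ _ ⟩
  (shift f ⋆ (g ⋆ h)) p + ((f ⋆ (shift g ⋆ h)) p + (f ⋆ (g ⋆ shift h)) p)
    ≡⟨ cong (_+_ ((shift f ⋆ (g ⋆ h)) p))
            (sym (trans (⋆-cong {f = f} (λ _ → refl) (⋆-shift g h) p) (⋆-distribˡ-+ f (shift g ⋆ h) (g ⋆ shift h) p))) ⟩
  (shift f ⋆ (g ⋆ h)) p + (f ⋆ shift (g ⋆ h)) p
    ≡⟨ sym (⋆-shift f (g ⋆ h) p) ⟩
  (f ⋆ (g ⋆ h)) (suc p)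
    ∎

⋆-cong-below : ∀ {g X Y : ℕ → ℤ} p → g 0 ≡ + 0 → (∀ i → i < p → X i ≡ Y i) → (g ⋆ X) p ≡ (g ⋆ Y) p
⋆-cong-below {g} {X} {Y} p g₀≡0 X≡Y = Σ≤-cong p term
  where
  vanishes : ∀ Z → + (p C 0) * g 0 * Z p ≡ + 0
  vanishes Z = trans (cong (λ z → + (p C 0) * z * Z p) g₀≡0)
                     (trans (cong (_* Z p) (ℤP.*-zeroʳ (+ (p C 0)))) (ℤP.*-zeroˡ (Z p)))
  term : ∀ j → j ≤ p → + (p C j) * g j * X (p ∸ j) ≡ + (p C j) * g j * Y (p ∸ j)
  term zero    _   = trans (vanishes X) (sym (vanishes Y))
  term (suc j) 1+j≤p = cong (_*_ (+ (p C suc j) * g (suc j))) (X≡Y (p ∸ suc j) (ℕP.∸-monoʳ-< ℕ.z<s 1+j≤p))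

⋆-recurrence-unique : ∀ {g c X Y : ℕ → ℤ} → g 0 ≡ + 0 →
                      (∀ p → X p ≡ c p + (g ⋆ X) p) → (∀ p → Y p ≡ c p + (g ⋆ Y) p) → X ≗ Y
⋆-recurrence-unique {g} {c} {X} {Y} g₀≡0 X-rec Y-rec = <-rec (λ p → X p ≡ Y p) step
  where
  step : ∀ p → (∀ {i} → i < p → X i ≡ Y i) → X p ≡ Y p
  step p X≡Y = begin
    X p              ≡⟨ X-rec p ⟩
    c p + (g ⋆ X) p  ≡⟨ cong (_+_ (c p)) (⋆-cong-below p g₀≡0 (λ _ → X≡Y)) ⟩
    c p + (g ⋆ Y) p  ≡⟨ sym (Y-rec p) ⟩
    Y p              ∎

twiceOdd : ℕ → ℤ
twiceOdd zero          = + 0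
twiceOdd (suc zero)    = + 2
twiceOdd (suc (suc n)) = twiceOdd n

twiceOdd≡1-sgn : ∀ p → twiceOdd p ≡ + 1 - sgn p
twiceOdd≡1-sgn zero          = refl
twiceOdd≡1-sgn (suc zero)    = refl
twiceOdd≡1-sgn (suc (suc p)) =
  trans (twiceOdd≡1-sgn p) (cong (λ x → + 1 - x) (sym (ℤP.neg-involutive (sgn p))))

twiceOdd-even : ∀ j → twiceOdd (j ℕ.+ j) ≡ + 0
twiceOdd-even zero    = refl
twiceOdd-even (suc j) rewrite ℕP.+-suc j j = twiceOdd-even j

twiceOdd-odd : ∀ j → twiceOdd (suc (j ℕ.+ j)) ≡ + 2
twiceOdd-odd zero    = refl
twiceOdd-odd (suc j) rewrite ℕP.+-suc j j = twiceOdd-odd j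

n≤1+⌊n/2⌋+⌊n/2⌋ : ∀ n → n ≤ suc (⌊ n /2⌋ ℕ.+ ⌊ n /2⌋)
n≤1+⌊n/2⌋+⌊n/2⌋ zero          = z≤n
n≤1+⌊n/2⌋+⌊n/2⌋ (suc zero)    = s≤s z≤n
n≤1+⌊n/2⌋+⌊n/2⌋ (suc (suc n)) rewrite ℕP.+-suc ⌊ n /2⌋ ⌊ n /2⌋ = s≤s (s≤s (n≤1+⌊n/2⌋+⌊n/2⌋ n))

oddSum≡twiceOdd⋆ : ∀ p X → oddSum p X ≡ (twiceOdd ⋆ X) p
oddSum≡twiceOdd⋆ p X = sym (begin
  Σ≤ p h                                            ≡⟨ Σ≤-extend h beyond-p (ℕP.≤⇒≤′ (n≤1+⌊n/2⌋+⌊n/2⌋ p)) ⟩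
  Σ≤ (suc (q ℕ.+ q)) h                              ≡⟨ Σ≤-pairs q h ⟩
  Σ≤ q (λ j → h (j ℕ.+ j) + h (suc (j ℕ.+ j)))      ≡⟨ Σ≤-cong q (λ j _ → pair j) ⟩
  Σ≤ q (λ j → + 2 * odd-term j)                     ≡⟨ Σ≤-*ˡ q (+ 2) odd-term ⟩
  oddSum p X                                        ∎)
  where
  q : ℕ
  q = ⌊ p /2⌋
  h odd-term : ℕ → ℤ
  h m = + (p C m) * twiceOdd m * X (p ∸ m)
  odd-term j = + (p C suc (j ℕ.+ j)) * X (p ∸ suc (j ℕ.+ j))
  beyond-p : ∀ j → p < j → h j ≡ + 0
  beyond-p j p<j = cong (λ c → + c * twiceOdd j * X (p ∸ j)) (k>n⇒nCk≡0 p<j)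
  collapse : ∀ c d x y → c * + 0 * y + d * + 2 * x ≡ + 2 * (d * x)
  collapse = solve-∀
  pair : ∀ j → h (j ℕ.+ j) + h (suc (j ℕ.+ j)) ≡ + 2 * odd-term j
  pair j rewrite twiceOdd-even j | twiceOdd-odd j =
    collapse (+ (p C (j ℕ.+ j))) (+ (p C suc (j ℕ.+ j))) (X (p ∸ suc (j ℕ.+ j))) (X (p ∸ (j ℕ.+ j)))

oddSum-cong : ∀ n {X Y : ℕ → ℤ} → (∀ i → i ≤ n → X i ≡ Y i) → oddSum (suc n) X ≡ oddSum (suc n) Y
oddSum-cong n X≡Y = cong (_*_ (+ 2)) (Σ≤-cong ⌊ suc n /2⌋ (λ j _ →
  cong (_*_ (+ (suc n C suc (j ℕ.+ j)))) (X≡Y (n ∸ (j ℕ.+ j)) (ℕP.m∸n≤m n (j ℕ.+ j)))))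

module Tabulation (T : ℕ → ℕ → ℤ) (next : ℕ → (ℕ → ℤ) → ℤ)
                  (T-suc : ∀ n i → T (suc n) i ≡ (if i ≤ᵇ n then T n i else next n (T n))) where

  n<ᵇn≡false : ∀ n → (n <ᵇ n) ≡ false
  n<ᵇn≡false zero    = refl
  n<ᵇn≡false (suc n) = n<ᵇn≡false n

  diagonal-suc : ∀ n → T (suc n) (suc n) ≡ next n (T n)
  diagonal-suc n =
    trans (T-suc n (suc n)) (cong (λ b → if b then T n (suc n) else next n (T n)) (n<ᵇn≡false n))

  table≡diagonal : ∀ n i → i ≤ n → T n i ≡ T i i
  table≡diagonal zero    zero    z≤n  = refl
  table≡diagonal (suc n) i       i≤1+n with i ≤ᵇ n | T-suc n i | ℕP.≤ᵇ-reflects-≤ i n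
  ... | true  | T-suc-i | ofʸ i≤n = trans T-suc-i (table≡diagonal n i i≤n)
  ... | false | T-suc-i | ofⁿ i≰n with ℕP.≤-antisym i≤1+n (ℕP.≰⇒> i≰n)
  ...   | refl = trans T-suc-i (sym (diagonal-suc n))

open Tabulation A-upto (λ n X → sgn (suc n) + oddSum (suc n) X) (λ _ _ → refl)
  renaming (diagonal-suc to A-suc; table≡diagonal to A-upto≡A)
open Tabulation B-upto (λ n X → oddSum (suc n) X) (λ _ _ → refl)
  renaming (diagonal-suc to B-suc; table≡diagonal to B-upto≡B)

A-rec : ∀ p → A p ≡ sgn p + (twiceOdd ⋆ A) p
A-rec zero    = refl
A-rec (suc n) = begin
  A (suc n)                                  ≡⟨ A-suc n ⟩
  sgn (suc n) + oddSum (suc n) (A-upto n)    ≡⟨ cong (_+_ (sgn (suc n))) (oddSum-cong n (A-upto≡A n)) ⟩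
  sgn (suc n) + oddSum (suc n) A             ≡⟨ cong (_+_ (sgn (suc n))) (oddSum≡twiceOdd⋆ (suc n) A) ⟩
  sgn (suc n) + (twiceOdd ⋆ A) (suc n)       ∎

B-rec : ∀ p → B p ≡ δ p + (twiceOdd ⋆ B) p
B-rec zero    = refl
B-rec (suc n) = begin
  B (suc n)                           ≡⟨ B-suc n ⟩
  oddSum (suc n) (B-upto n)           ≡⟨ oddSum-cong n (B-upto≡B n) ⟩
  oddSum (suc n) B                    ≡⟨ oddSum≡twiceOdd⋆ (suc n) B ⟩
  (twiceOdd ⋆ B) (suc n)              ≡⟨ sym (ℤP.+-identityˡ _) ⟩
  δ (suc n) + (twiceOdd ⋆ B) (suc n)  ∎

ones : ℕ → ℤ
ones _ = + 1

B⋆ones-rec : ∀ p → (B ⋆ ones) p ≡ ones p + (twiceOdd ⋆ (B ⋆ ones)) p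
B⋆ones-rec p = begin
  (B ⋆ ones) p                                       ≡⟨ ⋆-cong {g = ones} B-rec (λ _ → refl) p ⟩
  ((λ n → δ n + (twiceOdd ⋆ B) n) ⋆ ones) p          ≡⟨ ⋆-distribʳ-+ δ (twiceOdd ⋆ B) ones p ⟩
  (δ ⋆ ones) p + ((twiceOdd ⋆ B) ⋆ ones) p           ≡⟨ cong₂ _+_ (⋆-identityˡ ones p) (⋆-assoc twiceOdd B ones p) ⟩
  ones p + (twiceOdd ⋆ (B ⋆ ones)) p                 ∎

E : ℕ → ℤ
E p = (B ⋆ ones) p - B p + δ p

twiceOdd⋆E : ∀ p → (twiceOdd ⋆ E) p ≡ (twiceOdd ⋆ (B ⋆ ones)) p - (twiceOdd ⋆ B) p + twiceOdd p
twiceOdd⋆E p = begin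
  (twiceOdd ⋆ E) p
    ≡⟨ ⋆-distribˡ-+ twiceOdd (λ n → (B ⋆ ones) n - B n) δ p ⟩
  (twiceOdd ⋆ (λ n → (B ⋆ ones) n - B n)) p + (twiceOdd ⋆ δ) p
    ≡⟨ cong₂ _+_ (⋆-distribˡ-+ twiceOdd (B ⋆ ones) (λ n → - B n) p) (⋆-identityʳ twiceOdd p) ⟩
  (twiceOdd ⋆ (B ⋆ ones)) p + (twiceOdd ⋆ (λ n → - B n)) p + twiceOdd p
    ≡⟨ cong (λ x → (twiceOdd ⋆ (B ⋆ ones)) p + x + twiceOdd p) (⋆-negʳ twiceOdd B p) ⟩
  (twiceOdd ⋆ (B ⋆ ones)) p - (twiceOdd ⋆ B) p + twiceOdd p
    ∎

E-rec : ∀ p → E p ≡ sgn p + (twiceOdd ⋆ E) p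
E-rec p = begin
  E p                                ≡⟨ cong₂ (λ x y → x - y + δ p) (B⋆ones-rec p) (B-rec p) ⟩
  (+ 1 + ωF) - (δ p + ωB) + δ p      ≡⟨ rearrange (sgn p) ωF ωB (δ p) ⟩
  sgn p + (ωF - ωB + (+ 1 - sgn p))  ≡⟨ cong (λ x → sgn p + (ωF - ωB + x)) (sym (twiceOdd≡1-sgn p)) ⟩
  sgn p + (ωF - ωB + twiceOdd p)     ≡⟨ cong (_+_ (sgn p)) (sym (twiceOdd⋆E p)) ⟩
  sgn p + (twiceOdd ⋆ E) p           ∎
  where
  ωF ωB : ℤ
  ωF = (twiceOdd ⋆ (B ⋆ ones)) p
  ωB = (twiceOdd ⋆ B) p
  rearrange : ∀ s f b d → (+ 1 + f) - (d + b) + d ≡ s + (f - b + (+ 1 - s))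
  rearrange = solve-∀

⋆ones≡Σ<+last : ∀ (f : ℕ → ℤ) k → (f ⋆ ones) k ≡ Σ< k (λ j → + (k C j) * f j) + f k
⋆ones≡Σ<+last f k = begin
  (f ⋆ ones) k                   ≡⟨ Σ≤-cong k (λ j _ → ℤP.*-identityʳ (term j)) ⟩
  Σ≤ k term                      ≡⟨ Σ≤-Σ< k term ⟩
  Σ< k term + + (k C k) * f k    ≡⟨ cong (λ c → Σ< k term + + c * f k) (nCn≡1 k) ⟩
  Σ< k term + + 1 * f k          ≡⟨ cong (_+_ (Σ< k term)) (ℤP.*-identityˡ (f k)) ⟩
  Σ< k term + f k                ∎
  where
  term : ℕ → ℤ
  term j = + (k C j) * f j

mainTheorem4 : (k : ℕ) → k ≥ 1 → A k ≡ Σ< k (λ j → + (k C j) * B j)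
mainTheorem4 k@(suc _) _ = begin
  A k                               ≡⟨ ⋆-recurrence-unique {twiceOdd} {sgn} refl A-rec E-rec k ⟩
  (B ⋆ ones) k - B k + + 0          ≡⟨ cong (λ x → x - B k + + 0) (⋆ones≡Σ<+last B k) ⟩
  Σ< k binomB + B k - B k + + 0     ≡⟨ cancel (Σ< k binomB) (B k) ⟩
  Σ< k binomB                       ∎
  where
  binomB : ℕ → ℤ
  binomB j = + (k C j) * B j
  cancel : ∀ x b → x + b - b + + 0 ≡ x
  cancel = solve-∀
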